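{- Let $n,r,s$ be positive integers with $n>r$, and let $A\subset\mathbb{N}^n$ be $r$-wise $s$-union. For $1\leq i\leq n$ let $m_i=\max\{x_i:\mathbf x\in A\}$ and $\mathbf m=(m_1,\ldots,m_n)$. Assume that $n-r$ divides $|\mathbf m|-s$, that $d:=\frac{|\mathbf m|-s}{n-r}$ is non-negative, and that $a_i:=m_i-d\geq 0$ for all $1\leq i\leq n$; put $\mathbf a=(a_1,\ldots,a_n)$ (so $|\mathbf a|=s-rd$) and $P_i:=\mathbf a+d\mathbf e_i$ for $1\leq i\leq n$. Assume further that $\{P_1,\ldots,P_n\}\subset A$. Then \[ |A|\leq \max_{0\leq d'\leq\lfloor s/r\rfloor}\left|K(r,n,\mathbf a',d')\right|, \] where, for each $d'$, $\mathbf a'\in\mathbb{N}^n$ is a balanced partition with $|\mathbf a'|=s-rd'$. Moreover, if equality holds, then $A=K(r,n,\mathbf a',d')$ for some $0\leq d'\leq\lfloor s/r\rfloor$ and some balanced partition $\mathbf a'\in\mathbb{N}^n$ with $|\mathbf a'|=s-rd'$.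
   Context: $\mathbb{N}=\{0,1,2,\ldots\}$. For $\mathbf a\in\mathbb{N}^n$, $|\mathbf a|=\sum_i a_i$. The join of vectors is their componentwise maximum. $A\subset\mathbb{N}^n$ is $r$-wise $s$-union if the join of any $r$ vectors of $A$ (not necessarily distinct) has weight at most $s$. $\mathbf e_i$ is the $i$-th standard basis vector and $\mathbf 1=(1,\ldots,1)$. Write $\mathbf a\prec\mathbf b$ if $a_i\leq b_i$ for all $i$; $\mathcal{D}(\mathbf a)=\{\mathbf c\in\mathbb{N}^n:\mathbf c\prec\mathbf a\}$, $\mathcal{D}(B)=\bigcup_{\mathbf a\in B}\mathcal{D}(\mathbf a)$; $\mathcal{U}(\mathbf a,d)=\{\mathbf a+\boldsymbol\epsilon:\boldsymbol\epsilon\in\mathbb{N}^n,|\boldsymbol\epsilon|=d\}$. A vector $\mathbf a\in\mathbb{N}^n$ is a balanced partition if $|a_i-a_j|\leq 1$ for all $i,j$. For $0\leq d\leq\lfloor s/r\rfloor$ and $\mathbf a\in\mathbb{N}^n$ with $|\mathbf a|=s-rd$, with $u=n-r+1$, define \[ K(r,n,\mathbf a,d)=\bigcup_{i=0}^{\lfloor d/u\rfloor}\mathcal{D}(\mathcal{U}(\mathbf a+i\mathbf 1,d-ui)). \] -}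

module Defs where

open import Data.Nat using (ℕ; zero; suc; _+_; _*_; _∸_; _≤_; _<_; _⊔_; NonZero)
open import Data.Nat.DivMod using (_/_)
open import Data.Fin using (Fin)
open import Data.Vec using (Vec; []; _∷_; lookup; tabulate; replicate; zipWith; updateAt; sum)
import Data.Vec.Properties as VecP
open import Data.List using (List; []; _∷_; map; concatMap; upTo; foldr; length; deduplicate)
open import Data.List.Membership.Propositional using (_∈_)
open import Data.Product using (_×_)
open import Function.Bundles using (_⇔_)
open import Relation.Binary.PropositionalEquality using (_≡_)
import Data.Nat.Properties as NatP

∣_∣ᵥ : ∀ {n} → Vec ℕ n → ℕ
∣ a ∣ᵥ = sum a

_≺_ : ∀ {n} → Vec ℕ n → Vec ℕ n → Set
_≺_ {n} a b = (i : Fin n) → lookup a i ≤ lookup b i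

_+ᵥ_ : ∀ {n} → Vec ℕ n → Vec ℕ n → Vec ℕ n
_+ᵥ_ = zipWith _+_

const : ∀ n → ℕ → Vec ℕ n
const n i = replicate n i

plusAt : ∀ {n} → Vec ℕ n → Fin n → ℕ → Vec ℕ n
plusAt a i d = updateAt a i (_+ d)

-- join of r vectors (componentwise maximum); r ≥ 1 in all uses
join : ∀ {n r} → (Fin r → Vec ℕ n) → Vec ℕ n
join {n} {r} f = tabulate λ j → foldr _⊔_ 0 (map (λ k → lookup (f k) j) (Data.List.allFin r))
  where import Data.List

-- Finite subsets of ℕ^n are represented by duplicate-free lists.
-- A is r-wise s-union: join of any r (not necessarily distinct) members has weight ≤ s.
IsUnion : ∀ {n} → (r s : ℕ) → List (Vec ℕ n) → Set
IsUnion {n} r s A = (f : Fin r → Vec ℕ n) → ((k : Fin r) → f k ∈ A) → ∣ join f ∣ᵥ ≤ s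

-- m_i = max { x_i : x ∈ A }   (A is nonempty in all uses)
maxVec : ∀ {n} → List (Vec ℕ n) → Vec ℕ n
maxVec {n} A = tabulate λ i → foldr _⊔_ 0 (map (λ x → lookup x i) A)

Balanced : ∀ {n} → Vec ℕ n → Set
Balanced {n} a = (i j : Fin n) → lookup a i ≤ lookup a j + 1

𝒟₁ : ∀ {n} → Vec ℕ n → List (Vec ℕ n)
𝒟₁ [] = [] ∷ []
𝒟₁ (b ∷ bs) = concatMap (λ c → map (c ∷_) (𝒟₁ bs)) (upTo (suc b))

𝒟 : ∀ {n} → List (Vec ℕ n) → List (Vec ℕ n)
𝒟 B = concatMap 𝒟₁ B

weightVecs : (n d : ℕ) → List (Vec ℕ n)
weightVecs zero zero = [] ∷ []
weightVecs zero (suc d) = []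
weightVecs (suc n) d = concatMap (λ e → map (e ∷_) (weightVecs n (d ∸ e))) (upTo (suc d))

𝒰 : ∀ {n} → Vec ℕ n → ℕ → List (Vec ℕ n)
𝒰 {n} a d = map (a +ᵥ_) (weightVecs n d)

K : (r n : ℕ) → Vec ℕ n → ℕ → List (Vec ℕ n)
K r n a d = concatMap (λ i → 𝒟 (𝒰 (a +ᵥ const n i) (d ∸ u * i))) (upTo (suc (d / u)))
  where u = suc (n ∸ r)

∣K∣ : (r n : ℕ) → Vec ℕ n → ℕ → ℕ
∣K∣ r n a d = length (deduplicate (VecP.≡-dec NatP._≟_) (K r n a d))

maxUpTo : ℕ → (ℕ → ℕ) → ℕ
maxUpTo N f = foldr _⊔_ 0 (map f (upTo (suc N)))

_≐_ : ∀ {n} → List (Vec ℕ n) → List (Vec ℕ n) → Set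
_≐_ {n} A B = (x : Vec ℕ n) → (x ∈ A) ⇔ (x ∈ B)

-- (1) Membership: c ∈ K(r,n,a,d) iff u i + excess i a c ≤ d for some i, where
--     u = n - r + 1 and excess measures how far c leaves the box 𝒟(a + i𝟏).
-- (2) Compression: moving one unit of the base from a coordinate j to a smaller
--     coordinate k gives an injection of K into the new K, which misses a point
--     when a_j ≥ a_k + 2.  (3) Balancing: iterating (2) towards a balanced base
--     of the same weight can only increase |K|, strictly if we start unbalanced.
-- (4) Covering: A ⊆ K(r,n,a,d); for x ∈ A join x with the Pₗ on the r - 1
--     coordinates where x - a is smallest (for r = 1 use any base of weight 0).
module Submission where

open import Defs
open import Data.Nat using (ℕ; zero; suc; _+_; _*_; _∸_; _≤_; _<_; _⊔_; z≤n; s≤s; NonZero; _≤?_; _<?_)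
open import Data.Nat.Properties
open import Data.Nat.DivMod using (_/_; m*n/n≡m; /-monoˡ-≤; m/n*n≤m; n/1≡n)
open import Data.Nat.Tactic.RingSolver using (solve-∀)
open import Data.Fin using (Fin; zero; suc)
open import Data.Fin.Properties using (any?; all?; ¬∀⟶∃¬) renaming (_≟_ to _≟ᶠ_)
open import Data.Vec using (Vec; []; _∷_; lookup; map; tabulate; updateAt)
open import Data.Vec.Properties
  using (lookup∘updateAt; lookup∘updateAt′; lookup-zipWith; lookup-replicate; lookup∘tabulate; tabulate∘lookup; tabulate-cong)
  renaming (≡-dec to vec-≡-dec)
import Data.Vec.Functional as Vector
import Data.List.Membership.DecPropositional as DecMembership
open import Data.Vec.Functional.Properties using (updateAt-updates; updateAt-minimal)
import Data.List
open import Data.List using (List; []; _∷_; length; _++_; upTo; allFin; filter; foldr; concatMap; deduplicate) renaming (map to mapᴸ)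
open import Data.List.Properties using (length-map; length-++; length-tabulate)
open import Data.List.Membership.Propositional using (_∈_; _∉_; find; lose)
open import Data.List.Membership.Propositional.Properties
open import Data.List.Relation.Unary.Any using (here; there; index)
open import Data.List.Relation.Unary.Any.Properties using (lookup-index)
import Data.List.Relation.Unary.All as All
open import Data.List.Relation.Unary.All.Properties using (¬Any⇒All¬; All¬⇒¬Any; map⁺; all-filter)
open import Data.List.Relation.Unary.Unique.Propositional using (Unique; []; _∷_)
open import Data.List.Relation.Unary.Unique.DecPropositional.Properties using (deduplicate-!)
open import Data.List.Relation.Unary.Unique.Propositional.Properties using (allFin⁺)
open import Data.List.Extrema.Nat using (argmin; f[argmin]≤f[xs]; argmin-all)
open import Data.Product using (_×_; _,_; ∃-syntax; Σ-syntax; proj₁; proj₂)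
open import Data.Empty using (⊥-elim)
import Data.Empty.Irrelevant as Irrelevant
open import Data.Sum using (inj₁; inj₂)
open import Relation.Nullary using (¬_; ¬?; yes; no; Dec; decidable-stable)
open import Relation.Binary.PropositionalEquality
open import Function using (_∘_; mk⇔)
open import Algebra.Properties.CommutativeMonoid.Sum +-0-commutativeMonoid
  using (sum-cong-≗; ∑-distrib-+) renaming (sum to ∑)

∣∣ᵥ≡∑ : ∀ {n} (v : Vec ℕ n) → ∣ v ∣ᵥ ≡ ∑ (lookup v)
∣∣ᵥ≡∑ [] = refl
∣∣ᵥ≡∑ (x ∷ v) = cong (x +_) (∣∣ᵥ≡∑ v)

∑-mono : ∀ {n} {f g : Fin n → ℕ} → (∀ l → f l ≤ g l) → ∑ f ≤ ∑ g
∑-mono {zero} _ = z≤n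
∑-mono {suc n} f≤g = +-mono-≤ (f≤g zero) (∑-mono (f≤g ∘ suc))

∑-const : ∀ n c → ∑ {n} (λ _ → c) ≡ n * c
∑-const zero c = refl
∑-const (suc n) c = cong (c +_) (∑-const n c)

erase : ∀ {n} → Fin n → (Fin n → ℕ) → Fin n → ℕ
erase j f = Vector.updateAt f j (λ _ → 0)

erase-off : ∀ {n} (j : Fin n) f {l} → l ≢ j → erase j f l ≡ f l
erase-off j f {l} l≢j = updateAt-minimal l j f l≢j

∑-erase : ∀ {n} (f : Fin n → ℕ) j → ∑ f ≡ f j + ∑ (erase j f)
∑-erase f zero = refl
∑-erase f (suc j) = begin
  f zero + ∑ (f ∘ suc)                         ≡⟨ cong (f zero +_) (∑-erase (f ∘ suc) j) ⟩
  f zero + (f (suc j) + ∑ (erase j (f ∘ suc))) ≡⟨ x+[y+z]≡y+[x+z] (f zero) (f (suc j)) _ ⟩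
  f (suc j) + (f zero + ∑ (erase j (f ∘ suc))) ∎
  where
  open ≡-Reasoning
  x+[y+z]≡y+[x+z] : ∀ x y z → x + (y + z) ≡ y + (x + z)
  x+[y+z]≡y+[x+z] = solve-∀

∑-point : ∀ {n} (f : Fin n → ℕ) j → f j ≤ ∑ f
∑-point f j = ≤-trans (m≤m+n (f j) _) (≤-reflexive (sym (∑-erase f j)))

∑-≤-≡ : ∀ {n} {f g : Fin n → ℕ} → (∀ l → f l ≤ g l) → ∑ f ≡ ∑ g → ∀ l → f l ≡ g l
∑-≤-≡ {f = f} {g} f≤g ∑f≡∑g l = ≤-antisym (f≤g l) (+-cancelʳ-≤ (∑ (erase l f)) (g l) (f l) (begin
  g l + ∑ (erase l f) ≤⟨ +-monoʳ-≤ (g l) (∑-mono erase-mono) ⟩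
  g l + ∑ (erase l g) ≡⟨ sym (∑-erase g l) ⟩
  ∑ g                 ≡⟨ sym ∑f≡∑g ⟩
  ∑ f                 ≡⟨ ∑-erase f l ⟩
  f l + ∑ (erase l f) ∎))
  where
  open ≤-Reasoning
  erase-mono : ∀ l' → erase l f l' ≤ erase l g l'
  erase-mono l' with l' ≟ᶠ l
  ... | yes refl = ≤-reflexive (trans (updateAt-updates l f) (sym (updateAt-updates l g)))
  ... | no l'≢l = subst₂ _≤_ (sym (erase-off l f l'≢l)) (sym (erase-off l g l'≢l)) (f≤g l')

∑-erase₂ : ∀ {n} (f : Fin n → ℕ) {j k} → j ≢ k → ∑ f ≡ f j + (f k + ∑ (erase k (erase j f)))
∑-erase₂ f {j} {k} j≢k = begin
  ∑ f                                             ≡⟨ ∑-erase f j ⟩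
  f j + ∑ (erase j f)                             ≡⟨ cong (f j +_) (∑-erase (erase j f) k) ⟩
  f j + (erase j f k + ∑ (erase k (erase j f)))   ≡⟨ cong (λ x → f j + (x + ∑ (erase k (erase j f)))) (erase-off j f (j≢k ∘ sym)) ⟩
  f j + (f k + ∑ (erase k (erase j f)))           ∎
  where open ≡-Reasoning

∑-two-points : ∀ {n} {f g : Fin n → ℕ} {j k} → j ≢ k → (∀ l → l ≢ j → l ≢ k → f l ≡ g l) →
               ∑ f + (g j + g k) ≡ ∑ g + (f j + f k)
∑-two-points {f = f} {g} {j} {k} j≢k f≡g = begin
  ∑ f + (g j + g k)                                ≡⟨ cong (_+ (g j + g k)) (∑-erase₂ f j≢k) ⟩
  f j + (f k + ∑ (erase k (erase j f))) + (g j + g k) ≡⟨ cong (λ R → f j + (f k + R) + (g j + g k)) rest≡ ⟩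
  f j + (f k + ∑ (erase k (erase j g))) + (g j + g k) ≡⟨ rearrange (f j) (f k) (g j) (g k) (∑ (erase k (erase j g))) ⟩
  g j + (g k + ∑ (erase k (erase j g))) + (f j + f k) ≡⟨ cong (_+ (f j + f k)) (sym (∑-erase₂ g j≢k)) ⟩
  ∑ g + (f j + f k)                                ∎
  where
  open ≡-Reasoning
  rearrange : ∀ a b c d R → a + (b + R) + (c + d) ≡ c + (d + R) + (a + b)
  rearrange = solve-∀
  rest≡ : ∑ (erase k (erase j f)) ≡ ∑ (erase k (erase j g))
  rest≡ = sum-cong-≗ pointwise
    where
    pointwise : ∀ l → erase k (erase j f) l ≡ erase k (erase j g) l
    pointwise l with l ≟ᶠ k | l ≟ᶠ j
    ... | yes refl | _ = trans (updateAt-updates l (erase j f)) (sym (updateAt-updates l (erase j g)))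
    ... | no l≢k | yes refl = begin
      erase k (erase l f) l ≡⟨ erase-off k _ l≢k ⟩
      erase l f l           ≡⟨ updateAt-updates l f ⟩
      0                     ≡⟨ sym (updateAt-updates l g) ⟩
      erase l g l           ≡⟨ sym (erase-off k _ l≢k) ⟩
      erase k (erase l g) l ∎
    ... | no l≢k | no l≢j = begin
      erase k (erase j f) l ≡⟨ erase-off k _ l≢k ⟩
      erase j f l           ≡⟨ erase-off j f l≢j ⟩
      f l                   ≡⟨ f≡g l l≢j l≢k ⟩
      g l                   ≡⟨ sym (erase-off j g l≢j) ⟩
      erase j g l           ≡⟨ sym (erase-off k _ l≢k) ⟩
      erase k (erase j g) l ∎

∑-swap : ∀ {n} {f g : Fin n → ℕ} {j k} → j ≢ k → (∀ l → l ≢ j → l ≢ k → f l ≡ g l) →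
         f j + f k ≡ g j + g k → ∑ f ≡ ∑ g
∑-swap {f = f} {g} {j} {k} j≢k f≡g fjk≡gjk = +-cancelʳ-≡ _ (∑ f) (∑ g) (begin
  ∑ f + (g j + g k) ≡⟨ ∑-two-points j≢k f≡g ⟩
  ∑ g + (f j + f k) ≡⟨ cong (∑ g +_) fjk≡gjk ⟩
  ∑ g + (g j + g k) ∎)
  where open ≡-Reasoning

set₂ : ∀ {n} → Fin n → Fin n → ℕ → ℕ → Vec ℕ n → Vec ℕ n
set₂ j k x y v = updateAt (updateAt v j (λ _ → x)) k (λ _ → y)

module _ {n} (j k : Fin n) (x y : ℕ) (v : Vec ℕ n) where

  set₂-j : j ≢ k → lookup (set₂ j k x y v) j ≡ x
  set₂-j j≢k = trans (lookup∘updateAt′ j k {λ _ → y} j≢k (updateAt v j (λ _ → x))) (lookup∘updateAt j {λ _ → x} v)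

  set₂-k : lookup (set₂ j k x y v) k ≡ y
  set₂-k = lookup∘updateAt k {λ _ → y} (updateAt v j (λ _ → x))

  set₂-other : ∀ {l} → l ≢ j → l ≢ k → lookup (set₂ j k x y v) l ≡ lookup v l
  set₂-other {l} l≢j l≢k =
    trans (lookup∘updateAt′ l k {λ _ → y} l≢k (updateAt v j (λ _ → x))) (lookup∘updateAt′ l j {λ _ → x} l≢j v)

unique-⊆⇒≤ : ∀ {A : Set} {xs ys : List A} → Unique xs → (∀ {z} → z ∈ xs → z ∈ ys) → length xs ≤ length ys
unique-⊆⇒≤ {xs = []} _ _ = z≤n
unique-⊆⇒≤ {xs = x ∷ xs} {ys} (x∉xs ∷ xs-unique) xs⊆ys with ∈-∃++ (xs⊆ys (here refl))
... | ys₁ , ys₂ , refl = begin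
  suc (length xs)               ≤⟨ s≤s (unique-⊆⇒≤ xs-unique (λ z∈ → remove-x (xs⊆ys (there z∈)) (All.lookup x∉xs z∈))) ⟩
  suc (length (ys₁ ++ ys₂))     ≡⟨ cong suc (length-++ ys₁) ⟩
  suc (length ys₁ + length ys₂) ≡⟨ sym (+-suc (length ys₁) (length ys₂)) ⟩
  length ys₁ + length (x ∷ ys₂) ≡⟨ sym (length-++ ys₁) ⟩
  length (ys₁ ++ x ∷ ys₂)       ∎
  where
  open ≤-Reasoning
  remove-x : ∀ {z} → z ∈ ys₁ ++ x ∷ ys₂ → x ≢ z → z ∈ ys₁ ++ ys₂
  remove-x z∈ x≢z with ∈-++⁻ ys₁ z∈
  ... | inj₁ z∈ys₁ = ∈-++⁺ˡ z∈ys₁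
  ... | inj₂ (here z≡x) = ⊥-elim (x≢z (sym z≡x))
  ... | inj₂ (there z∈ys₂) = ∈-++⁺ʳ ys₁ z∈ys₂

module _ {A B : Set} (f : A → B) {xs : List A} {ys : List B} (xs-unique : Unique xs)
         (f-injective : ∀ {x y} → x ∈ xs → y ∈ xs → f x ≡ f y → x ≡ y)
         (f-into : ∀ {x} → x ∈ xs → f x ∈ ys) where

  private
    image-unique : ∀ {zs} → Unique zs → (∀ {x} → x ∈ zs → x ∈ xs) → Unique (mapᴸ f zs)
    image-unique [] _ = []
    image-unique {z ∷ zs} (z∉zs ∷ zs-unique) zs⊆xs =
      map⁺ (All.tabulate λ w∈zs fz≡fw → All.lookup z∉zs w∈zs (f-injective (zs⊆xs (here refl)) (zs⊆xs (there w∈zs)) fz≡fw))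
      ∷ image-unique zs-unique (zs⊆xs ∘ there)

    image⊆ys : ∀ {w} → w ∈ mapᴸ f xs → w ∈ ys
    image⊆ys w∈ with ∈-map⁻ f w∈
    ... | x , x∈xs , refl = f-into x∈xs

  injection-≤ : length xs ≤ length ys
  injection-≤ = subst (_≤ length ys) (length-map f xs) (unique-⊆⇒≤ (image-unique xs-unique (λ x∈ → x∈)) image⊆ys)

  injection-< : (z : B) → z ∈ ys → (∀ {x} → x ∈ xs → f x ≢ z) → length xs < length ys
  injection-< z z∈ys missed = subst (_≤ length ys) (cong suc (length-map f xs))
    (unique-⊆⇒≤ (¬Any⇒All¬ _ z∉image ∷ image-unique xs-unique (λ x∈ → x∈)) z∷image⊆ys)
    where
    z∉image : z ∉ mapᴸ f xs
    z∉image z∈ with ∈-map⁻ f z∈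
    ... | x , x∈xs , z≡fx = missed x∈xs (sym z≡fx)
    z∷image⊆ys : ∀ {w} → w ∈ z ∷ mapᴸ f xs → w ∈ ys
    z∷image⊆ys (here refl) = z∈ys
    z∷image⊆ys (there w∈) = image⊆ys w∈

distinct : ∀ {n} → List (Vec ℕ n) → List (Vec ℕ n)
distinct = deduplicate (vec-≡-dec _≟_)

distinct-unique : ∀ {n} (xs : List (Vec ℕ n)) → Unique (distinct xs)
distinct-unique = deduplicate-! (vec-≡-dec _≟_)

∈-distinct⁺ : ∀ {n} {xs : List (Vec ℕ n)} {z} → z ∈ xs → z ∈ distinct xs
∈-distinct⁺ = ∈-deduplicate⁺ (vec-≡-dec _≟_)

∈-distinct⁻ : ∀ {n} (xs : List (Vec ℕ n)) {z} → z ∈ distinct xs → z ∈ xs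
∈-distinct⁻ = ∈-deduplicate⁻ (vec-≡-dec _≟_)

_∈ᵥ?_ : ∀ {n} (x : Vec ℕ n) (xs : List (Vec ℕ n)) → Dec (x ∈ xs)
x ∈ᵥ? xs = DecMembership._∈?_ (vec-≡-dec _≟_) x xs

unique-⊆⇒≤-distinct : ∀ {n} {xs ys : List (Vec ℕ n)} → Unique xs → (∀ {z} → z ∈ xs → z ∈ ys) →
                      length xs ≤ length (distinct ys)
unique-⊆⇒≤-distinct xs-unique xs⊆ys = unique-⊆⇒≤ xs-unique (∈-distinct⁺ ∘ xs⊆ys)

unique-⊆-saturated : ∀ {n} {xs ys : List (Vec ℕ n)} → Unique xs → (∀ {z} → z ∈ xs → z ∈ ys) →
                     length (distinct ys) ≤ length xs → ∀ {z} → z ∈ ys → z ∈ xs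
unique-⊆-saturated {xs = xs} {ys} xs-unique xs⊆ys ys≤xs {z} z∈ys with z ∈ᵥ? xs
... | yes z∈xs = z∈xs
... | no z∉xs = ⊥-elim (<⇒≱ (unique-⊆⇒≤-distinct (¬Any⇒All¬ xs z∉xs ∷ xs-unique) z∷xs⊆ys) ys≤xs)
  where
  z∷xs⊆ys : ∀ {w} → w ∈ z ∷ xs → w ∈ ys
  z∷xs⊆ys (here refl) = z∈ys
  z∷xs⊆ys (there w∈xs) = xs⊆ys w∈xs

∈-concatMap-∃ : ∀ {A B : Set} (f : A → List B) {xs : List A} {y} → y ∈ concatMap f xs → ∃[ x ] (x ∈ xs × y ∈ f x)
∈-concatMap-∃ f y∈ = find (∈-concatMap⁻ f y∈)

∈-concatMap-intro : ∀ {A B : Set} (f : A → List B) {xs : List A} {x y} → x ∈ xs → y ∈ f x → y ∈ concatMap f xs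
∈-concatMap-intro f x∈ y∈ = ∈-concatMap⁺ f (lose x∈ y∈)

𝒟₁-sound : ∀ {n} (b c : Vec ℕ n) → c ∈ 𝒟₁ b → c ≺ b
𝒟₁-sound (b ∷ bs) (c ∷ cs) c∈ l with ∈-concatMap-∃ (λ c₀ → mapᴸ (c₀ ∷_) (𝒟₁ bs)) {upTo (suc b)} c∈
... | c₀ , c₀∈ , c∈′ with ∈-map⁻ (c₀ ∷_) c∈′
... | cs′ , cs∈ , refl with l
...   | zero = ≤-pred (∈-upTo⁻ c₀∈)
...   | suc l′ = 𝒟₁-sound bs cs cs∈ l′

𝒟₁-complete : ∀ {n} (b c : Vec ℕ n) → c ≺ b → c ∈ 𝒟₁ b
𝒟₁-complete [] [] _ = here refl
𝒟₁-complete (b ∷ bs) (c ∷ cs) c≺b = ∈-concatMap-intro (λ c₀ → mapᴸ (c₀ ∷_) (𝒟₁ bs))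
  (∈-upTo⁺ (s≤s (c≺b zero))) (∈-map⁺ (c ∷_) (𝒟₁-complete bs cs (c≺b ∘ suc)))

weightVecs-sound : ∀ n d (e : Vec ℕ n) → e ∈ weightVecs n d → ∣ e ∣ᵥ ≡ d
weightVecs-sound zero zero [] _ = refl
weightVecs-sound (suc n) d (e ∷ es) e∈ with ∈-concatMap-∃ (λ e₀ → mapᴸ (e₀ ∷_) (weightVecs n (d ∸ e₀))) {upTo (suc d)} e∈
... | e₀ , e₀∈ , e∈′ with ∈-map⁻ (e₀ ∷_) e∈′
... | es′ , es∈ , refl =
  trans (cong (e₀ +_) (weightVecs-sound n (d ∸ e₀) es es∈)) (m+[n∸m]≡n (≤-pred (∈-upTo⁻ e₀∈)))

weightVecs-complete : ∀ n (e : Vec ℕ n) → e ∈ weightVecs n ∣ e ∣ᵥ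
weightVecs-complete zero [] = here refl
weightVecs-complete (suc n) (e ∷ es) =
  ∈-concatMap-intro (λ e₀ → mapᴸ (e₀ ∷_) (weightVecs n (e + ∣ es ∣ᵥ ∸ e₀))) (∈-upTo⁺ (s≤s (m≤m+n e ∣ es ∣ᵥ)))
    (∈-map⁺ (e ∷_) (subst (λ t → es ∈ weightVecs n t) (sym (m+n∸m≡n e ∣ es ∣ᵥ)) (weightVecs-complete n es)))

-- width r n = n - r + 1 is the price, in the budget d, of raising the base of
-- K(r,n,a,d) by 𝟏; i ranges over 0 … ⌊d / width⌋ in the definition of K.
width : ℕ → ℕ → ℕ
width r n = suc (n ∸ r)

≤/⇒*≤ : ∀ {i d} u .{{_ : NonZero u}} → i ≤ d / u → u * i ≤ d
≤/⇒*≤ {i} {d} u i≤d/u = ≤-trans (*-monoʳ-≤ u i≤d/u) (subst (_≤ d) (*-comm (d / u) u) (m/n*n≤m d u))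

*≤⇒≤/ : ∀ {i d} u .{{_ : NonZero u}} → u * i ≤ d → i ≤ d / u
*≤⇒≤/ {i} {d} u ui≤d = subst (_≤ d / u) (m*n/n≡m i u) (/-monoˡ-≤ u (subst (_≤ d) (*-comm u i) ui≤d))

-- excess i a c = Σₗ gap i a c l = Σₗ (cₗ ∸ (aₗ + i)): the total amount by which
-- c sticks out of the box 𝒟(a + i𝟏).
gap : ∀ {n} → ℕ → Vec ℕ n → Vec ℕ n → Fin n → ℕ
gap i a c l = lookup c l ∸ (lookup a l + i)

excess : ∀ {n} → ℕ → Vec ℕ n → Vec ℕ n → ℕ
excess i a c = ∑ (gap i a c)

-- The membership criterion for K: c lies in 𝒟(𝒰(a + i𝟏, d - u i)) exactly when
-- u i + excess i a c ≤ d.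
InK : (r n : ℕ) → Vec ℕ n → ℕ → Vec ℕ n → Set
InK r n a d c = ∃[ i ] (width r n * i + excess i a c ≤ d)

lookup-box : ∀ {n} (a ε : Vec ℕ n) i l → lookup ((a +ᵥ const n i) +ᵥ ε) l ≡ lookup a l + i + lookup ε l
lookup-box {n} a ε i l = begin
  lookup ((a +ᵥ const n i) +ᵥ ε) l         ≡⟨ lookup-zipWith _+_ l (a +ᵥ const n i) ε ⟩
  lookup (a +ᵥ const n i) l + lookup ε l   ≡⟨ cong (_+ lookup ε l) (lookup-zipWith _+_ l a (const n i)) ⟩
  lookup a l + lookup (const n i) l + lookup ε l ≡⟨ cong (λ t → lookup a l + t + lookup ε l) (lookup-replicate l i) ⟩
  lookup a l + i + lookup ε l              ∎
  where open ≡-Reasoning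

-- Soundness of the criterion: a point of 𝒟(a + i𝟏 + ε) with |ε| = d - u i
-- exceeds a + i𝟏 by at most |ε|.
K-sound : ∀ r n a d {c} → c ∈ K r n a d → InK r n a d c
K-sound r n a d {c} c∈K
  with ∈-concatMap-∃ (λ i → 𝒟 (𝒰 (a +ᵥ const n i) (d ∸ width r n * i))) {upTo (suc (d / width r n))} c∈K
... | i , i∈ , c∈𝒟 with ∈-concatMap-∃ 𝒟₁ {𝒰 (a +ᵥ const n i) (d ∸ width r n * i)} c∈𝒟
... | b , b∈𝒰 , c∈𝒟₁ with ∈-map⁻ ((a +ᵥ const n i) +ᵥ_) b∈𝒰
... | ε , ε∈ , refl = i , (begin
  u * i + excess i a c  ≤⟨ +-monoʳ-≤ (u * i) (∑-mono c-a-i≤ε) ⟩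
  u * i + ∑ (lookup ε)  ≡⟨ cong (u * i +_) (trans (sym (∣∣ᵥ≡∑ ε)) (weightVecs-sound n _ ε ε∈)) ⟩
  u * i + (d ∸ u * i)   ≡⟨ m+[n∸m]≡n (≤/⇒*≤ u (≤-pred (∈-upTo⁻ i∈))) ⟩
  d                     ∎)
  where
  open ≤-Reasoning
  u = width r n
  c-a-i≤ε : ∀ l → gap i a c l ≤ lookup ε l
  c-a-i≤ε l = begin
    lookup c l ∸ (lookup a l + i)
      ≤⟨ ∸-monoˡ-≤ (lookup a l + i) (𝒟₁-sound ((a +ᵥ const n i) +ᵥ ε) c c∈𝒟₁ l) ⟩
    lookup ((a +ᵥ const n i) +ᵥ ε) l ∸ (lookup a l + i) ≡⟨ cong (_∸ (lookup a l + i)) (lookup-box a ε i l) ⟩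
    lookup a l + i + lookup ε l ∸ (lookup a l + i) ≡⟨ m+n∸m≡n (lookup a l + i) (lookup ε l) ⟩
    lookup ε l                                    ∎

pad : ∀ {m} (v : Vec ℕ (suc m)) t → ∃[ ε ] (v ≺ ε × ∣ ε ∣ᵥ ≡ ∣ v ∣ᵥ + t)
pad (x ∷ v) t = x + t ∷ v , v≺ε , x+t+y≡x+y+t x t ∣ v ∣ᵥ
  where
  v≺ε : (x ∷ v) ≺ (x + t ∷ v)
  v≺ε zero = m≤m+n x t
  v≺ε (suc l) = ≤-refl
  x+t+y≡x+y+t : ∀ x t y → x + t + y ≡ x + y + t
  x+t+y≡x+y+t = solve-∀

-- Completeness: if u i + excess i a c ≤ d, pad the overflow of c over a + i𝟏
-- to a vector ε of weight d - u i; then c ∈ 𝒟(a + i𝟏 + ε) ⊆ K.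
K-complete : ∀ r {n} → 0 < n → ∀ a d {c} → InK r n a d c → c ∈ K r n a d
K-complete r {suc m} _ a d {c} (i , ui+e≤d) =
  ∈-concatMap-intro (λ i → 𝒟 (𝒰 (a +ᵥ const n i) (d ∸ u * i))) (∈-upTo⁺ (s≤s (*≤⇒≤/ u ui≤d)))
    (∈-concatMap-intro 𝒟₁
      (∈-map⁺ ((a +ᵥ const n i) +ᵥ_) (subst (λ t → ε ∈ weightVecs n t) ∣ε∣≡ (weightVecs-complete n ε)))
      (𝒟₁-complete ((a +ᵥ const n i) +ᵥ ε) c c≺box))
  where
  n = suc m
  u = width r n
  ui≤d : u * i ≤ d
  ui≤d = m+n≤o⇒m≤o (u * i) ui+e≤d
  e≤d-ui : excess i a c ≤ d ∸ u * i
  e≤d-ui = subst (_≤ d ∸ u * i) (m+n∸m≡n (u * i) _) (∸-monoˡ-≤ (u * i) ui+e≤d)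
  overflow : Vec ℕ n
  overflow = tabulate (gap i a c)
  ∣overflow∣ : ∣ overflow ∣ᵥ ≡ excess i a c
  ∣overflow∣ = trans (∣∣ᵥ≡∑ overflow) (sum-cong-≗ (lookup∘tabulate (gap i a c)))
  ε = proj₁ (pad overflow (d ∸ u * i ∸ excess i a c))
  overflow≺ε = proj₁ (proj₂ (pad overflow (d ∸ u * i ∸ excess i a c)))
  ∣ε∣≡ : ∣ ε ∣ᵥ ≡ d ∸ u * i
  ∣ε∣≡ = begin
    ∣ ε ∣ᵥ                                     ≡⟨ proj₂ (proj₂ (pad overflow _)) ⟩
    ∣ overflow ∣ᵥ + (d ∸ u * i ∸ excess i a c) ≡⟨ cong (_+ (d ∸ u * i ∸ excess i a c)) ∣overflow∣ ⟩
    excess i a c + (d ∸ u * i ∸ excess i a c)  ≡⟨ m+[n∸m]≡n e≤d-ui ⟩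
    d ∸ u * i                                  ∎
    where open ≡-Reasoning
  c≺box : c ≺ ((a +ᵥ const n i) +ᵥ ε)
  c≺box l = begin
    lookup c l                                          ≤⟨ m≤n+m∸n (lookup c l) (lookup a l + i) ⟩
    lookup a l + i + (lookup c l ∸ (lookup a l + i))    ≡⟨ cong (lookup a l + i +_) (sym (lookup∘tabulate (gap i a c) l)) ⟩
    lookup a l + i + lookup overflow l                  ≤⟨ +-monoʳ-≤ (lookup a l + i) (overflow≺ε l) ⟩
    lookup a l + i + lookup ε l                         ≡⟨ sym (lookup-box a ε i l) ⟩
    lookup ((a +ᵥ const n i) +ᵥ ε) l                    ∎
    where open ≤-Reasoning

K-transfer : ∀ r {n} → 0 < n → ∀ {a a′ c c′ : Vec ℕ n} d → (∀ i → excess i a′ c′ ≤ excess i a c) →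
             c ∈ K r n a d → c′ ∈ K r n a′ d
K-transfer r n>0 {a} {a′} {c} {c′} d smaller c∈K with K-sound r _ a d c∈K
... | i , ui+e≤d = K-complete r n>0 a′ d (i , ≤-trans (+-monoʳ-≤ (width r _ * i) (smaller i)) ui+e≤d)

vec-ext : ∀ {n} {v w : Vec ℕ n} → (∀ l → lookup v l ≡ lookup w l) → v ≡ w
vec-ext {v = v} {w} v≗w = trans (sym (tabulate∘lookup v)) (trans (tabulate-cong v≗w) (tabulate∘lookup w))

-- Let a_k < a_j and δ = a_j - a_k - 1.  The base a′ = a - 𝐞_j + 𝐞_k is at least
-- as good: |K(a)| ≤ |K(a′)|, strictly so when δ ≥ 1.  The injection K(a) → K(a′)
-- keeps the points already in K(a′) and applies to the others the map σ that
-- exchanges c_j and c_k, shifted by δ.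
module Compression (r n : ℕ) (n>0 : 0 < n) (a : Vec ℕ n) (d : ℕ) (j k : Fin n) (j≢k : j ≢ k)
                   (aₖ<aⱼ : lookup a k < lookup a j) where

  private
    aⱼ = lookup a j
    aₖ = lookup a k

  δ : ℕ
  δ = aⱼ ∸ suc aₖ

  aⱼ≡ : aⱼ ≡ δ + suc aₖ
  aⱼ≡ = sym (m∸n+n≡m aₖ<aⱼ)

  a′ : Vec ℕ n
  a′ = set₂ j k (aₖ + δ) (suc aₖ) a

  a′ⱼ : lookup a′ j ≡ aₖ + δ
  a′ⱼ = set₂-j j k (aₖ + δ) (suc aₖ) a j≢k

  a′ₖ : lookup a′ k ≡ suc aₖ
  a′ₖ = set₂-k j k (aₖ + δ) (suc aₖ) a

  a′-other : ∀ {l} → l ≢ j → l ≢ k → lookup a′ l ≡ lookup a l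
  a′-other = set₂-other j k (aₖ + δ) (suc aₖ) a

  suc-a′ⱼ : suc (lookup a′ j) ≡ aⱼ
  suc-a′ⱼ = trans (cong suc a′ⱼ) (trans (sym (+-suc aₖ δ)) (trans (+-comm aₖ (suc δ)) (trans (sym (+-suc δ aₖ)) (sym aⱼ≡))))

  ∣a′∣≡∣a∣ : ∣ a′ ∣ᵥ ≡ ∣ a ∣ᵥ
  ∣a′∣≡∣a∣ = begin
    ∣ a′ ∣ᵥ       ≡⟨ ∣∣ᵥ≡∑ a′ ⟩
    ∑ (lookup a′) ≡⟨ ∑-swap j≢k (λ _ → a′-other) (trans (cong₂ _+_ a′ⱼ a′ₖ) (trans (moved aₖ δ) (cong (_+ aₖ) (sym aⱼ≡))))
                   ⟩
    ∑ (lookup a)  ≡⟨ sym (∣∣ᵥ≡∑ a) ⟩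
    ∣ a ∣ᵥ        ∎
    where
    open ≡-Reasoning
    moved : ∀ x δ → x + δ + suc x ≡ δ + suc x + x
    moved = solve-∀

  σ : Vec ℕ n → Vec ℕ n
  σ c = set₂ j k (lookup c k + δ) (lookup c j ∸ δ) c

  σⱼ : ∀ c → lookup (σ c) j ≡ lookup c k + δ
  σⱼ c = set₂-j j k (lookup c k + δ) (lookup c j ∸ δ) c j≢k

  σₖ : ∀ c → lookup (σ c) k ≡ lookup c j ∸ δ
  σₖ c = set₂-k j k (lookup c k + δ) (lookup c j ∸ δ) c

  σ-other : ∀ c {l} → l ≢ j → l ≢ k → lookup (σ c) l ≡ lookup c l
  σ-other c = set₂-other j k (lookup c k + δ) (lookup c j ∸ δ) c

  private
    shift-up : ∀ x y → (x + δ) ∸ (δ + y) ≡ x ∸ y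
    shift-up x y = trans (cong (_∸ (δ + y)) (+-comm x δ)) ([m+n]∸[m+o]≡n∸o δ x y)

    a′ⱼ+i : ∀ i → lookup a′ j + i ≡ δ + (aₖ + i)
    a′ⱼ+i i = trans (cong (_+ i) (trans a′ⱼ (+-comm aₖ δ))) (+-assoc δ aₖ i)

    aⱼ+i : ∀ i → aⱼ + i ≡ δ + (lookup a′ k + i)
    aⱼ+i i = trans (cong (_+ i) aⱼ≡) (trans (+-assoc δ (suc aₖ) i) (cong (λ t → δ + (t + i)) (sym a′ₖ)))

  excess-σ : ∀ i c → excess i a′ (σ c) ≡ excess i a c
  excess-σ i c = ∑-swap j≢k outside (trans (cong₂ _+_ at-j at-k) (+-comm (gap i a c k) (gap i a c j)))
    where
    outside : ∀ l → l ≢ j → l ≢ k → gap i a′ (σ c) l ≡ gap i a c l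
    outside l l≢j l≢k = cong₂ _∸_ (σ-other c l≢j l≢k) (cong (_+ i) (a′-other l≢j l≢k))
    at-j : gap i a′ (σ c) j ≡ gap i a c k
    at-j = trans (cong₂ _∸_ (σⱼ c) (a′ⱼ+i i)) (shift-up (lookup c k) (aₖ + i))
    at-k : gap i a′ (σ c) k ≡ gap i a c j
    at-k = trans (cong (_∸ (lookup a′ k + i)) (σₖ c))
                 (trans (∸-+-assoc (lookup c j) δ (lookup a′ k + i)) (cong (lookup c j ∸_) (sym (aⱼ+i i))))

  excess-σ′ : ∀ i c → excess i a (σ c) ≡ excess i a′ c
  excess-σ′ i c = ∑-swap j≢k outside (trans (cong₂ _+_ at-j at-k) (+-comm (gap i a′ c k) (gap i a′ c j)))
    where
    outside : ∀ l → l ≢ j → l ≢ k → gap i a (σ c) l ≡ gap i a′ c l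
    outside l l≢j l≢k = cong₂ _∸_ (σ-other c l≢j l≢k) (cong (_+ i) (sym (a′-other l≢j l≢k)))
    at-j : gap i a (σ c) j ≡ gap i a′ c k
    at-j = trans (cong₂ _∸_ (σⱼ c) (aⱼ+i i)) (shift-up (lookup c k) (lookup a′ k + i))
    at-k : gap i a (σ c) k ≡ gap i a′ c j
    at-k = trans (cong (_∸ (aₖ + i)) (σₖ c))
                 (trans (∸-+-assoc (lookup c j) δ (aₖ + i)) (cong (lookup c j ∸_) (sym (a′ⱼ+i i))))

  Ka Ka′ : List (Vec ℕ n)
  Ka = K r n a d
  Ka′ = K r n a′ d

  σ-into : ∀ {c} → c ∈ Ka → σ c ∈ Ka′
  σ-into {c} = K-transfer r n>0 d (λ i → ≤-reflexive (excess-σ i c))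

  σ-back : ∀ {c} → σ c ∈ Ka → c ∈ Ka′
  σ-back {c} = K-transfer r n>0 d (λ i → ≤-reflexive (sym (excess-σ′ i c)))

  -- A point of K(a) with c_j < δ already lies in K(a′): its excess only drops.
  small-in-Ka′ : ∀ {c} → lookup c j < δ → c ∈ Ka → c ∈ Ka′
  small-in-Ka′ {c} cⱼ<δ = K-transfer r n>0 d (λ i → ∑-mono (gap-drops i))
    where
    gap-drops : ∀ i l → gap i a′ c l ≤ gap i a c l
    gap-drops i l with l ≟ᶠ j | l ≟ᶠ k
    ... | yes refl | _ = ≤-trans (≤-reflexive (m≤n⇒m∸n≡0 cⱼ≤a′ⱼ+i)) z≤n
      where
      cⱼ≤a′ⱼ+i : lookup c l ≤ lookup a′ l + i
      cⱼ≤a′ⱼ+i = ≤-trans (<⇒≤ cⱼ<δ) (≤-trans (m≤m+n δ (aₖ + i)) (≤-reflexive (sym (a′ⱼ+i i))))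
    ... | no _ | yes refl = ∸-monoʳ-≤ (lookup c l) (+-monoˡ-≤ i (≤-trans (n≤1+n aₖ) (≤-reflexive (sym a′ₖ))))
    ... | no l≢j | no l≢k = ≤-reflexive (cong (λ t → lookup c l ∸ (t + i)) (a′-other l≢j l≢k))

  -- So the points of K(a) outside K(a′) have c_j ≥ δ, where σ is injective.
  big-outside-Ka′ : ∀ {c} → c ∈ Ka → c ∉ Ka′ → δ ≤ lookup c j
  big-outside-Ka′ {c} c∈Ka c∉Ka′ with δ ≤? lookup c j
  ... | yes δ≤cⱼ = δ≤cⱼ
  ... | no δ≰cⱼ = ⊥-elim (c∉Ka′ (small-in-Ka′ (≰⇒> δ≰cⱼ) c∈Ka))

  σ-injective : ∀ {x y} → δ ≤ lookup x j → δ ≤ lookup y j → σ x ≡ σ y → x ≡ y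
  σ-injective {x} {y} δ≤xⱼ δ≤yⱼ σx≡σy = vec-ext coordinates
    where
    σ-coord : ∀ l → lookup (σ x) l ≡ lookup (σ y) l
    σ-coord l = cong (λ v → lookup v l) σx≡σy
    coordinates : ∀ l → lookup x l ≡ lookup y l
    coordinates l with l ≟ᶠ j | l ≟ᶠ k
    ... | yes refl | _ = begin
      lookup x l               ≡⟨ sym (m∸n+n≡m δ≤xⱼ) ⟩
      lookup x l ∸ δ + δ       ≡⟨ cong (_+ δ) (trans (sym (σₖ x)) (trans (σ-coord k) (σₖ y))) ⟩
      lookup y l ∸ δ + δ       ≡⟨ m∸n+n≡m δ≤yⱼ ⟩
      lookup y l               ∎
      where open ≡-Reasoning
    ... | no _ | yes refl = +-cancelʳ-≡ δ _ _ (trans (sym (σⱼ x)) (trans (σ-coord j) (σⱼ y)))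
    ... | no l≢j | no l≢k = trans (sym (σ-other x l≢j l≢k)) (trans (σ-coord l) (σ-other y l≢j l≢k))

  φ : Vec ℕ n → Vec ℕ n
  φ c with c ∈ᵥ? Ka′
  ... | yes _ = c
  ... | no _ = σ c

  -- φ is an injection of K(a) into K(a′): φ c = σ c only for c ∉ K(a′), and then
  -- a collision with some c′ = φ c′ ∈ K(a′) would put c′ = σ c in K(a), so c ∈ K(a′).
  φ-into : ∀ {c} → c ∈ Ka → φ c ∈ Ka′
  φ-into {c} c∈Ka with c ∈ᵥ? Ka′
  ... | yes c∈Ka′ = c∈Ka′
  ... | no _ = σ-into c∈Ka

  φ-injective : ∀ {x y} → x ∈ Ka → y ∈ Ka → φ x ≡ φ y → x ≡ y
  φ-injective {x} {y} x∈Ka y∈Ka φx≡φy with x ∈ᵥ? Ka′ | y ∈ᵥ? Ka′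
  ... | yes _ | yes _ = φx≡φy
  ... | no x∉ | no y∉ = σ-injective (big-outside-Ka′ x∈Ka x∉) (big-outside-Ka′ y∈Ka y∉) φx≡φy
  ... | yes _ | no y∉ = ⊥-elim (y∉ (σ-back (subst (_∈ Ka) φx≡φy x∈Ka)))
  ... | no x∉ | yes _ = ⊥-elim (x∉ (σ-back (subst (_∈ Ka) (sym φx≡φy) y∈Ka)))

  compress : ∣K∣ r n a d ≤ ∣K∣ r n a′ d
  compress = injection-≤ φ (distinct-unique Ka)
    (λ x∈ y∈ → φ-injective (∈-distinct⁻ Ka x∈) (∈-distinct⁻ Ka y∈))
    (λ x∈ → ∈-distinct⁺ (φ-into (∈-distinct⁻ Ka x∈)))

  -- A point of K(a′) missed by φ: z = a with (a_j, a_k) replaced by (0, a_k + 1 + d).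
  z : Vec ℕ n
  z = set₂ j k 0 (suc aₖ + d) a

  zⱼ : lookup z j ≡ 0
  zⱼ = set₂-j j k 0 (suc aₖ + d) a j≢k

  zₖ : lookup z k ≡ suc aₖ + d
  zₖ = set₂-k j k 0 (suc aₖ + d) a

  z-other : ∀ {l} → l ≢ j → l ≢ k → lookup z l ≡ lookup a l
  z-other = set₂-other j k 0 (suc aₖ + d) a

  -- With i = 0, z sticks out of 𝒟(a′) only at k, and by exactly d.
  z∈Ka′ : z ∈ Ka′
  z∈Ka′ = K-complete r n>0 a′ d (0 , ≤-reflexive (begin
    width r n * 0 + excess 0 a′ z                    ≡⟨ cong (_+ excess 0 a′ z) (*-zeroʳ (width r n)) ⟩
    excess 0 a′ z                                    ≡⟨ ∑-erase (gap 0 a′ z) k ⟩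
    gap 0 a′ z k + ∑ (erase k (gap 0 a′ z))
      ≡⟨ cong₂ _+_ at-k (trans (sum-cong-≗ vanishes) (trans (∑-const n 0) (*-zeroʳ n))) ⟩
    d + 0                                            ≡⟨ +-identityʳ d ⟩
    d                                                ∎))
    where
    open ≡-Reasoning
    at-k : gap 0 a′ z k ≡ d
    at-k = trans (cong₂ _∸_ zₖ (trans (+-identityʳ _) a′ₖ)) (m+n∸m≡n (suc aₖ) d)
    vanishes : ∀ l → erase k (gap 0 a′ z) l ≡ 0
    vanishes l with l ≟ᶠ k | l ≟ᶠ j
    ... | yes refl | _ = updateAt-updates l (gap 0 a′ z)
    ... | no l≢k | yes refl = trans (erase-off k _ l≢k) (trans (cong (_∸ (lookup a′ l + 0)) zⱼ) (0∸n≡0 (lookup a′ l + 0)))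
    ... | no l≢k | no l≢j = trans (erase-off k _ l≢k)
      (trans (cong₂ _∸_ (z-other l≢j l≢k) (trans (+-identityʳ _) (a′-other l≢j l≢k))) (n∸n≡0 (lookup a l)))

  -- For every i, already the k-th coordinate of z overshoots the budget d.
  z∉Ka : z ∉ Ka
  z∉Ka z∈Ka with K-sound r n a d z∈Ka
  ... | i , ui+e≤d = <⇒≱ (s≤s ≤-refl) (≤-trans overshoot ui+e≤d)
    where
    open ≤-Reasoning
    gapₖ : gap i a z k ≡ suc d ∸ i
    gapₖ = trans (cong (_∸ (aₖ + i)) (trans zₖ (sym (+-suc aₖ d)))) ([m+n]∸[m+o]≡n∸o aₖ (suc d) i)
    overshoot : suc d ≤ width r n * i + excess i a z
    overshoot = begin
      suc d                         ≤⟨ m≤n+m∸n (suc d) i ⟩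
      i + (suc d ∸ i)               ≡⟨ cong (i +_) (sym gapₖ) ⟩
      i + gap i a z k               ≤⟨ +-mono-≤ (m≤n*m i (width r n)) (∑-point (gap i a z) k) ⟩
      width r n * i + excess i a z  ∎

  -- φ misses z: z ∉ K(a), and σ x has j-th coordinate ≥ δ > 0.
  φ-misses-z : 0 < δ → ∀ {x} → x ∈ Ka → φ x ≢ z
  φ-misses-z δ>0 {x} x∈Ka φx≡z with x ∈ᵥ? Ka′
  ... | yes _ = z∉Ka (subst (_∈ Ka) φx≡z x∈Ka)
  ... | no _ = <⇒≱ δ>0 (≤-trans (m≤n+m δ (lookup x k)) (≤-reflexive σxⱼ≡0))
    where
    σxⱼ≡0 : lookup x k + δ ≡ 0
    σxⱼ≡0 = trans (sym (σⱼ x)) (trans (cong (λ v → lookup v j) φx≡z) zⱼ)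

  compress-strict : 0 < δ → ∣K∣ r n a d < ∣K∣ r n a′ d
  compress-strict δ>0 = injection-< φ (distinct-unique Ka)
    (λ x∈ y∈ → φ-injective (∈-distinct⁻ Ka x∈) (∈-distinct⁻ Ka y∈))
    (λ x∈ → ∈-distinct⁺ (φ-into (∈-distinct⁻ Ka x∈)))
    z (∈-distinct⁺ z∈Ka′) (λ x∈ → φ-misses-z δ>0 (∈-distinct⁻ Ka x∈))

below-equal : ∀ {n} {v w : Vec ℕ n} → (∀ l → lookup v l ≤ lookup w l) → ∣ v ∣ᵥ ≡ ∣ w ∣ᵥ → v ≡ w
below-equal {v = v} {w} v≤w ∣v∣≡∣w∣ = vec-ext (∑-≤-≡ v≤w (trans (sym (∣∣ᵥ≡∑ v)) (trans ∣v∣≡∣w∣ (∣∣ᵥ≡∑ w))))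

balanced? : ∀ {n} (a : Vec ℕ n) → Dec (Balanced a)
balanced? a = all? (λ i → all? (λ j → lookup a i ≤? lookup a j + 1))

unbalanced-pair : ∀ {n} (a : Vec ℕ n) → ¬ Balanced a → ∃[ j ] ∃[ k ] (suc (lookup a k) < lookup a j)
unbalanced-pair {n} a unbalanced
  with ¬∀⟶∃¬ n _ (λ i → all? (λ j → lookup a i ≤? lookup a j + 1)) unbalanced
... | j , aⱼ-too-big with ¬∀⟶∃¬ n _ (λ k → lookup a j ≤? lookup a k + 1) aⱼ-too-big
... | k , aⱼ≰aₖ+1 = j , k , subst (_< lookup a j) (+-comm (lookup a k) 1) (≰⇒> aⱼ≰aₖ+1)

module Balancing (r n : ℕ) (n>0 : 0 < n) (d : ℕ) (b : Vec ℕ n) (b-balanced : Balanced b) where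

  -- How far a lies above b; compression towards b decreases it.
  surplus : Vec ℕ n → ℕ
  surplus a = ∑ (λ l → lookup a l ∸ lookup b l)

  step : ∀ a → ∣ a ∣ᵥ ≡ ∣ b ∣ᵥ → a ≢ b →
         ∃[ a′ ] (∣ a′ ∣ᵥ ≡ ∣ b ∣ᵥ × surplus a′ < surplus a × ∣K∣ r n a d ≤ ∣K∣ r n a′ d)
  step a ∣a∣≡∣b∣ a≢b with any? (λ l → lookup b l <? lookup a l) | any? (λ l → lookup a l <? lookup b l)
  ... | no nowhere-above | _ = ⊥-elim (a≢b (below-equal (λ l → ≮⇒≥ (λ bₗ<aₗ → nowhere-above (l , bₗ<aₗ))) ∣a∣≡∣b∣))
  ... | _ | no nowhere-below =
    ⊥-elim (a≢b (sym (below-equal (λ l → ≮⇒≥ (λ aₗ<bₗ → nowhere-below (l , aₗ<bₗ))) (sym ∣a∣≡∣b∣))))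
  ... | yes (j , bⱼ<aⱼ) | yes (k , aₖ<bₖ) = a′ , trans ∣a′∣≡∣a∣ ∣a∣≡∣b∣ , ≤-reflexive closer , compress
    where
    j≢k : j ≢ k
    j≢k refl = <-asym bⱼ<aⱼ aₖ<bₖ
    aₖ<aⱼ : lookup a k < lookup a j
    aₖ<aⱼ = ≤-trans aₖ<bₖ (≤-trans (subst (lookup b k ≤_) (+-comm (lookup b j) 1) (b-balanced k j)) bⱼ<aⱼ)
    open Compression r n n>0 a d j k j≢k aₖ<aⱼ
    f g : Fin n → ℕ
    f l = lookup a′ l ∸ lookup b l
    g l = lookup a l ∸ lookup b l
    fⱼ : suc (f j) ≡ g j
    fⱼ = trans (sym (+-∸-assoc 1 (≤-pred (subst (lookup b j <_) (sym suc-a′ⱼ) bⱼ<aⱼ)))) (cong (_∸ lookup b j) suc-a′ⱼ)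
    fₖ : f k ≡ g k
    fₖ = trans (m≤n⇒m∸n≡0 (subst (_≤ lookup b k) (sym a′ₖ) aₖ<bₖ)) (sym (m≤n⇒m∸n≡0 (<⇒≤ aₖ<bₖ)))
    closer : suc (surplus a′) ≡ surplus a
    closer = +-cancelʳ-≡ (f j + f k) _ _ (begin
      suc (∑ f) + (f j + f k) ≡⟨ cong (_+ (f j + f k)) (+-comm 1 (∑ f)) ⟩
      ∑ f + 1 + (f j + f k)   ≡⟨ +-assoc (∑ f) 1 (f j + f k) ⟩
      ∑ f + (suc (f j) + f k) ≡⟨ cong (∑ f +_) (cong₂ _+_ fⱼ fₖ) ⟩
      ∑ f + (g j + g k)       ≡⟨ ∑-two-points j≢k (λ l l≢j l≢k → cong (_∸ lookup b l) (a′-other l≢j l≢k)) ⟩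
      ∑ g + (f j + f k)       ∎)
      where open ≡-Reasoning

  -- Iterate step; the surplus bounds the number of steps.
  balance-≤ : ∀ a → ∣ a ∣ᵥ ≡ ∣ b ∣ᵥ → ∣K∣ r n a d ≤ ∣K∣ r n b d
  balance-≤ a ∣a∣≡∣b∣ = descend (suc (surplus a)) a ≤-refl ∣a∣≡∣b∣
    where
    descend : ∀ N a → surplus a < N → ∣ a ∣ᵥ ≡ ∣ b ∣ᵥ → ∣K∣ r n a d ≤ ∣K∣ r n b d
    descend (suc N) a surplus<N ∣a∣≡∣b∣ with vec-≡-dec _≟_ a b
    ... | yes refl = ≤-refl
    ... | no a≢b with step a ∣a∣≡∣b∣ a≢b
    ... | a′ , ∣a′∣≡∣b∣ , closer , a≤a′ =
      ≤-trans a≤a′ (descend N a′ (<-≤-trans closer (≤-pred surplus<N)) ∣a′∣≡∣b∣)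

  balance-< : ∀ a → ∣ a ∣ᵥ ≡ ∣ b ∣ᵥ → ¬ Balanced a → ∣K∣ r n a d < ∣K∣ r n b d
  balance-< a ∣a∣≡∣b∣ unbalanced with unbalanced-pair a unbalanced
  ... | j , k , aₖ+1<aⱼ = <-≤-trans (compress-strict δ>0) (balance-≤ a′ (trans ∣a′∣≡∣a∣ ∣a∣≡∣b∣))
    where
    j≢k : j ≢ k
    j≢k refl = <-asym (n<1+n (lookup a j)) aₖ+1<aⱼ
    open Compression r n n>0 a d j k j≢k (<-trans (n<1+n (lookup a k)) aₖ+1<aⱼ)
    δ>0 : 0 < δ
    δ>0 = subst (_≤ δ) (m+n∸m≡n (suc (lookup a k)) 1) (∸-monoˡ-≤ (suc (lookup a k)) (subst (_≤ lookup a j) (+-comm 1 _) aₖ+1<aⱼ))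

_∈ᶠ?_ : ∀ {n} (l : Fin n) (S : List (Fin n)) → Dec (l ∈ S)
l ∈ᶠ? S = DecMembership._∈?_ _≟ᶠ_ l S

record ThresholdSplit {n} (y : Fin n → ℕ) (t : ℕ) : Set where
  field
    low        : List (Fin n)
    low-unique : Unique low
    low-size   : length low ≡ t
    θ          : ℕ
    low≤θ      : ∀ {l} → l ∈ low → y l ≤ θ
    θ≤high     : ∀ {l} → l ∉ low → θ ≤ y l

outside-short-list : ∀ {n} (S : List (Fin n)) → length S < n → ∃[ w ] (w ∉ S)
outside-short-list {n} S S<n with any? (λ l → ¬? (l ∈ᶠ? S))
... | yes w∉S = w∉S
... | no none = ⊥-elim (<⇒≱ S<n (subst (_≤ length S) (length-tabulate (λ l → l)) all⊆S))
  where
  all⊆S : length (allFin n) ≤ length S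
  all⊆S = unique-⊆⇒≤ (allFin⁺ n) (λ {l} _ → decidable-stable (l ∈ᶠ? S) (λ l∉S → none (l , l∉S)))

-- Built greedily: add a coordinate of minimal value among those not yet taken.
threshold-split : ∀ {n} (y : Fin n → ℕ) t → t ≤ n → ThresholdSplit y t
threshold-split y zero _ = record
  { low = [] ; low-unique = [] ; low-size = refl ; θ = 0 ; low≤θ = λ () ; θ≤high = λ _ → z≤n }
threshold-split {n} y (suc t) t<n with threshold-split y t (<⇒≤ t<n)
... | split with outside-short-list (low split) (subst (_< n) (sym (low-size split)) t<n)
  where open ThresholdSplit
... | w , w∉low = record
  { low = l₀ ∷ low
  ; low-unique = ¬Any⇒All¬ low l₀∉low ∷ low-unique
  ; low-size = cong suc low-size
  ; θ = y l₀
  ; low≤θ = λ { (here refl) → ≤-refl ; (there l∈low) → ≤-trans (low≤θ l∈low) (θ≤high l₀∉low) }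
  ; θ≤high = λ l∉ → l₀-minimal (l∉ ∘ there)
  }
  where
  open ThresholdSplit split
  candidates : List (Fin n)
  candidates = filter (λ l → ¬? (l ∈ᶠ? low)) (allFin n)
  l₀ : Fin n
  l₀ = argmin y w candidates
  l₀∉low : l₀ ∉ low
  l₀∉low = argmin-all y w∉low (all-filter (λ l → ¬? (l ∈ᶠ? low)) (allFin n))
  l₀-minimal : ∀ {l} → l ∉ low → y l₀ ≤ y l
  l₀-minimal l∉low = All.lookup (f[argmin]≤f[xs] w candidates) (∈-filter⁺ (λ l → ¬? (l ∈ᶠ? low)) (∈-allFin _) l∉low)

choose : ∀ {n} → List (Fin n) → (Fin n → ℕ) → (Fin n → ℕ) → Fin n → ℕ
choose S f g l with l ∈ᶠ? S
... | yes _ = f l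
... | no _ = g l

module _ {n} (S : List (Fin n)) (f g : Fin n → ℕ) {l : Fin n} where

  choose-∈ : l ∈ S → choose S f g l ≡ f l
  choose-∈ l∈S with l ∈ᶠ? S
  ... | yes _ = refl
  ... | no l∉S = ⊥-elim (l∉S l∈S)

  choose-∉ : l ∉ S → choose S f g l ≡ g l
  choose-∉ l∉S with l ∈ᶠ? S
  ... | yes l∈S = ⊥-elim (l∉S l∈S)
  ... | no _ = refl

∑-count : ∀ {n} (S : List (Fin n)) → Unique S → ∀ c → ∑ (choose S (λ _ → c) (λ _ → 0)) ≡ length S * c
∑-count {n} [] [] c = trans (∑-const n 0) (*-zeroʳ n)
∑-count (x ∷ S) (x∉S ∷ S-unique) c = begin
  ∑ (χ (x ∷ S))                       ≡⟨ ∑-erase (χ (x ∷ S)) x ⟩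
  χ (x ∷ S) x + ∑ (erase x (χ (x ∷ S))) ≡⟨ cong₂ _+_ (χ-∈ (x ∷ S) (here refl)) (sum-cong-≗ rest) ⟩
  c + ∑ (χ S)                         ≡⟨ cong (c +_) (∑-count S S-unique c) ⟩
  c + length S * c                    ∎
  where
  open ≡-Reasoning
  χ : List (Fin _) → Fin _ → ℕ
  χ T = choose T (λ _ → c) (λ _ → 0)
  χ-∈ : ∀ T {l} → l ∈ T → χ T l ≡ c
  χ-∈ T = choose-∈ T (λ _ → c) (λ _ → 0)
  χ-∉ : ∀ T {l} → l ∉ T → χ T l ≡ 0
  χ-∉ T = choose-∉ T (λ _ → c) (λ _ → 0)
  rest : ∀ l → erase x (χ (x ∷ S)) l ≡ χ S l
  rest l with l ≟ᶠ x
  ... | yes refl = trans (updateAt-updates l (χ (x ∷ S))) (sym (χ-∉ S (All¬⇒¬Any x∉S)))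
  ... | no l≢x = trans (erase-off x _ l≢x) (same (l ∈ᶠ? S))
    where
    same : Dec (l ∈ S) → χ (x ∷ S) l ≡ χ S l
    same (yes l∈S) = trans (χ-∈ (x ∷ S) (there l∈S)) (sym (χ-∈ S l∈S))
    same (no l∉S) = trans (χ-∉ (x ∷ S) l∉x∷S) (sym (χ-∉ S l∉S))
      where
      l∉x∷S : l ∉ x ∷ S
      l∉x∷S (here l≡x) = l≢x l≡x
      l∉x∷S (there l∈S) = l∉S l∈S

foldr-⊔-upper : ∀ {v} vs → v ∈ vs → v ≤ foldr _⊔_ 0 vs
foldr-⊔-upper (w ∷ vs) (here refl) = m≤m⊔n w _
foldr-⊔-upper (w ∷ vs) (there v∈vs) = ≤-trans (foldr-⊔-upper vs v∈vs) (m≤n⊔m w _)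

join-upper : ∀ {n r} (f : Fin r → Vec ℕ n) k → f k ≺ join f
join-upper f k l = subst (lookup (f k) l ≤_) (sym (lookup∘tabulate _ l))
  (foldr-⊔-upper _ (∈-map⁺ (λ k → lookup (f k) l) (∈-allFin k)))

member-weight : ∀ {n r s} {A : List (Vec ℕ n)} → IsUnion (suc r) s A → ∀ {x} → x ∈ A → ∣ x ∣ᵥ ≤ s
member-weight {r = r} {s} A-union {x} x∈A = begin
  ∣ x ∣ᵥ                   ≡⟨ ∣∣ᵥ≡∑ x ⟩
  ∑ (lookup x)             ≤⟨ ∑-mono (join-upper {r = suc r} (λ _ → x) zero) ⟩
  ∑ (lookup (join {r = suc r} (λ _ → x))) ≡⟨ sym (∣∣ᵥ≡∑ (join {r = suc r} (λ _ → x))) ⟩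
  ∣ join {r = suc r} (λ _ → x) ∣ᵥ ≤⟨ A-union (λ _ → x) (λ _ → x∈A) ⟩
  s                        ∎
  where open ≤-Reasoning

plusAt-at : ∀ {n} (a : Vec ℕ n) l d → lookup (plusAt a l d) l ≡ lookup a l + d
plusAt-at a l d = lookup∘updateAt l a

plusAt-≥ : ∀ {n} (a : Vec ℕ n) i d → a ≺ plusAt a i d
plusAt-≥ a i d l with i ≟ᶠ l
... | yes refl = ≤-trans (m≤m+n (lookup a i) d) (≤-reflexive (sym (plusAt-at a i d)))
... | no i≢l = ≤-reflexive (sym (lookup∘updateAt′ l i (i≢l ∘ sym) a))

m+[n∸m]≤n⊔m : ∀ m n → m + (n ∸ m) ≤ n ⊔ m
m+[n∸m]≤n⊔m m n with ≤-total m n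
... | inj₁ m≤n = ≤-trans (≤-reflexive (m+[n∸m]≡n m≤n)) (m≤m⊔n n m)
... | inj₂ n≤m = ≤-trans (≤-reflexive (trans (cong (m +_) (m≤n⇒m∸n≡0 n≤m)) (+-identityʳ m))) (m≤n⊔m n m)

weight-∸ : ∀ {n} d (v : Vec ℕ n) → (∀ l → d ≤ lookup v l) → ∣ map (_∸ d) v ∣ᵥ + n * d ≡ ∣ v ∣ᵥ
weight-∸ d [] _ = refl
weight-∸ {suc n} d (x ∷ v) d≤v = begin
  x ∸ d + ∣ map (_∸ d) v ∣ᵥ + (d + n * d) ≡⟨ regroup (x ∸ d) ∣ map (_∸ d) v ∣ᵥ d (n * d) ⟩
  (x ∸ d + d) + (∣ map (_∸ d) v ∣ᵥ + n * d) ≡⟨ cong₂ _+_ (m∸n+n≡m (d≤v zero)) (weight-∸ d v (d≤v ∘ suc)) ⟩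
  x + ∣ v ∣ᵥ                              ∎
  where
  open ≡-Reasoning
  regroup : ∀ p q d e → p + q + (d + e) ≡ p + d + (q + e)
  regroup = solve-∀

enumerate : ∀ {X : Set} (S : List X) {t} → length S ≡ t → Σ[ g ∈ (Fin t → X) ] (∀ {l} → l ∈ S → ∃[ q ] (g q ≡ l))
enumerate S refl = Data.List.lookup S , λ l∈S → index l∈S , sym (lookup-index l∈S)

record Cover (r s n : ℕ) (A : List (Vec ℕ n)) : Set where
  field
    depth  : ℕ
    base   : Vec ℕ n
    weight : ∣ base ∣ᵥ + r * depth ≡ s
    covers : ∀ {x} → x ∈ A → x ∈ K r n base depth

-- r = 1: all vectors of weight at most s lie in K(1,n,b,s) for any b of weight 0.
cover₁ : ∀ {n s} → 0 < n → (A : List (Vec ℕ n)) → IsUnion 1 s A →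
         (b : Vec ℕ n) → ∣ b ∣ᵥ ≡ s ∸ 1 * s → Cover 1 s n A
cover₁ {n} {s} n>0 A A-union b ∣b∣≡ = record
  { depth = s ; base = b ; weight = trans (cong (_+ 1 * s) ∣b∣≡) (m∸n+n≡m (≤-reflexive (*-identityˡ s))) ; covers = covers }
  where
  covers : ∀ {x} → x ∈ A → x ∈ K 1 n b s
  covers {x} x∈A = K-complete 1 n>0 b s (0 , (begin
    width 1 n * 0 + excess 0 b x ≡⟨ cong (_+ excess 0 b x) (*-zeroʳ (width 1 n)) ⟩
    excess 0 b x                 ≤⟨ ∑-mono (λ l → m∸n≤m (lookup x l) (lookup b l + 0)) ⟩
    ∑ (lookup x)                 ≡⟨ sym (∣∣ᵥ≡∑ x) ⟩
    ∣ x ∣ᵥ                       ≤⟨ member-weight A-union x∈A ⟩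
    s                            ∎))
    where open ≤-Reasoning

-- For x ∈ A put y = x - a (truncated) and let low be the r - 1 coordinates where
-- y is smallest, θ the largest of those values.  Joining x with the points
-- a + d𝐞ₗ (l ∈ low) gives |a| + (r-1)d + Σ_{l ∉ low} yₗ ≤ s = |a| + r d, so the
-- part of y outside low totals at most d; and u θ + excess θ a x is exactly that
-- total, as there are u = n - r + 1 coordinates outside low, all with yₗ ≥ θ.
module Covering (n r″ s : ℕ) (r<n : suc (suc r″) < n) (A : List (Vec ℕ n))
                (A-union : IsUnion (suc (suc r″)) s A) (d : ℕ)
                (∣m∣≡ : ∣ maxVec A ∣ᵥ ≡ s + (n ∸ suc (suc r″)) * d)
                (d≤m : (i : Fin n) → d ≤ lookup (maxVec A) i)
                (P∈A : (i : Fin n) → plusAt (map (_∸ d) (maxVec A)) i d ∈ A) where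

  r′ r u : ℕ
  r′ = suc r″
  r = suc r′
  u = width r n

  a : Vec ℕ n
  a = map (_∸ d) (maxVec A)

  n>0 : 0 < n
  n>0 = ≤-trans (s≤s z≤n) r<n

  n≡u+r′ : n ≡ u + r′
  n≡u+r′ = trans (sym (m∸n+n≡m (<⇒≤ r<n))) (+-suc (n ∸ r) r′)

  weight : ∣ a ∣ᵥ + r * d ≡ s
  weight = +-cancelʳ-≡ ((n ∸ r) * d) _ _ (begin
    ∣ a ∣ᵥ + r * d + (n ∸ r) * d   ≡⟨ +-assoc ∣ a ∣ᵥ (r * d) ((n ∸ r) * d) ⟩
    ∣ a ∣ᵥ + (r * d + (n ∸ r) * d)
      ≡⟨ cong (∣ a ∣ᵥ +_) (trans (sym (*-distribʳ-+ d r (n ∸ r))) (cong (_* d) (m+[n∸m]≡n (<⇒≤ r<n)))) ⟩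
    ∣ a ∣ᵥ + n * d                  ≡⟨ weight-∸ d (maxVec A) d≤m ⟩
    ∣ maxVec A ∣ᵥ                   ≡⟨ ∣m∣≡ ⟩
    s + (n ∸ r) * d                 ∎)
    where open ≡-Reasoning

  module _ {x : Vec ℕ n} (x∈A : x ∈ A) where

    y : Fin n → ℕ
    y l = lookup x l ∸ lookup a l

    open ThresholdSplit (threshold-split y r′ (≤-trans (n≤1+n r′) (<⇒≤ r<n)))

    outside : ℕ
    outside = ∑ (choose low (λ _ → 0) y)

    ∑-on-low : ∀ c → ∑ (choose low (λ _ → c) (λ _ → 0)) ≡ r′ * c
    ∑-on-low c = trans (∑-count low low-unique c) (cong (_* c) low-size)

    private
      g : Fin r′ → Fin n
      g = proj₁ (enumerate low low-size)

    members : Fin r → Vec ℕ n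
    members zero = x
    members (suc q) = plusAt a (g q) d

    members∈A : ∀ k → members k ∈ A
    members∈A zero = x∈A
    members∈A (suc q) = P∈A (g q)

    join-dominates : ∀ l → lookup a l + choose low (λ _ → d) y l ≤ lookup (join members) l
    join-dominates l = by-membership (l ∈ᶠ? low)
      where
      by-membership : Dec (l ∈ low) → lookup a l + choose low (λ _ → d) y l ≤ lookup (join members) l
      by-membership (yes l∈low) with proj₂ (enumerate low low-size) l∈low
      ... | q , refl = begin
        lookup a l + choose low (λ _ → d) y l ≡⟨ cong (lookup a l +_) (choose-∈ low (λ _ → d) y l∈low) ⟩
        lookup a l + d                        ≡⟨ sym (plusAt-at a l d) ⟩
        lookup (members (suc q)) l            ≤⟨ join-upper members (suc q) l ⟩
        lookup (join members) l               ∎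
        where open ≤-Reasoning
      by-membership (no l∉low) = begin
        lookup a l + choose low (λ _ → d) y l ≡⟨ cong (lookup a l +_) (choose-∉ low (λ _ → d) y l∉low) ⟩
        lookup a l + y l                      ≤⟨ m+[n∸m]≤n⊔m (lookup a l) (lookup x l) ⟩
        lookup x l ⊔ lookup a l
          ≤⟨ ⊔-lub (join-upper members zero l) (≤-trans (plusAt-≥ a (g zero) d l) (join-upper members (suc zero) l)) ⟩
        lookup (join members) l               ∎
        where open ≤-Reasoning

    outside≤d : outside ≤ d
    outside≤d = +-cancelˡ-≤ (∣ a ∣ᵥ + r′ * d) outside d (begin
      ∣ a ∣ᵥ + r′ * d + outside                               ≡⟨ +-assoc ∣ a ∣ᵥ (r′ * d) outside ⟩
      ∣ a ∣ᵥ + (r′ * d + outside)                             ≡⟨ cong (∣ a ∣ᵥ +_) (cong (_+ outside) (sym (∑-on-low d))) ⟩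
      ∣ a ∣ᵥ + (∑ (choose low (λ _ → d) (λ _ → 0)) + outside)
        ≡⟨ cong (∣ a ∣ᵥ +_) (sym (∑-distrib-+ (choose low (λ _ → d) (λ _ → 0)) (choose low (λ _ → 0) y))) ⟩
      ∣ a ∣ᵥ + ∑ (λ l → choose low (λ _ → d) (λ _ → 0) l + choose low (λ _ → 0) y l)
                                                              ≡⟨ cong₂ _+_ (∣∣ᵥ≡∑ a) (sum-cong-≗ split-d-y) ⟩
      ∑ (lookup a) + ∑ (choose low (λ _ → d) y)               ≡⟨ sym (∑-distrib-+ (lookup a) _) ⟩
      ∑ (λ l → lookup a l + choose low (λ _ → d) y l)         ≤⟨ ∑-mono join-dominates ⟩
      ∑ (lookup (join members))                               ≡⟨ sym (∣∣ᵥ≡∑ (join members)) ⟩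
      ∣ join members ∣ᵥ                                       ≤⟨ A-union members members∈A ⟩
      s                                                       ≡⟨ sym weight ⟩
      ∣ a ∣ᵥ + (d + r′ * d)                                   ≡⟨ sym (+-assoc ∣ a ∣ᵥ d (r′ * d)) ⟩
      ∣ a ∣ᵥ + d + r′ * d                                     ≡⟨ x+y+z≡x+z+y ∣ a ∣ᵥ d (r′ * d) ⟩
      ∣ a ∣ᵥ + r′ * d + d                                     ∎)
      where
      open ≤-Reasoning
      x+y+z≡x+z+y : ∀ x y z → x + y + z ≡ x + z + y
      x+y+z≡x+z+y = solve-∀
      split-d-y : ∀ l → choose low (λ _ → d) (λ _ → 0) l + choose low (λ _ → 0) y l ≡ choose low (λ _ → d) y l
      split-d-y l with l ∈ᶠ? low
      ... | yes _ = +-identityʳ d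
      ... | no _ = refl

    θ-outside : u * θ ≡ ∑ (choose low (λ _ → 0) (λ _ → θ))
    θ-outside = +-cancelʳ-≡ (r′ * θ) _ _ (begin
      u * θ + r′ * θ    ≡⟨ sym (*-distribʳ-+ θ u r′) ⟩
      (u + r′) * θ      ≡⟨ cong (_* θ) (sym n≡u+r′) ⟩
      n * θ             ≡⟨ sym (∑-const n θ) ⟩
      ∑ {n} (λ _ → θ)   ≡⟨ sym (sum-cong-≗ θ-splits) ⟩
      ∑ (λ l → choose low (λ _ → 0) (λ _ → θ) l + choose low (λ _ → θ) (λ _ → 0) l)
                        ≡⟨ ∑-distrib-+ (choose low (λ _ → 0) (λ _ → θ)) (choose low (λ _ → θ) (λ _ → 0)) ⟩
      ∑ (choose low (λ _ → 0) (λ _ → θ)) + ∑ (choose low (λ _ → θ) (λ _ → 0))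
                        ≡⟨ cong (∑ (choose low (λ _ → 0) (λ _ → θ)) +_) (∑-on-low θ) ⟩
      ∑ (choose low (λ _ → 0) (λ _ → θ)) + r′ * θ ∎)
      where
      open ≡-Reasoning
      θ-splits : ∀ l → choose low (λ _ → 0) (λ _ → θ) l + choose low (λ _ → θ) (λ _ → 0) l ≡ θ
      θ-splits l with l ∈ᶠ? low
      ... | yes _ = refl
      ... | no _ = +-identityʳ θ

    excess-at-θ : u * θ + excess θ a x ≡ outside
    excess-at-θ = begin
      u * θ + excess θ a x
        ≡⟨ cong₂ _+_ θ-outside (sum-cong-≗ excess-off-low) ⟩
      ∑ (choose low (λ _ → 0) (λ _ → θ)) + ∑ (choose low (λ _ → 0) (λ l → y l ∸ θ))
        ≡⟨ sym (∑-distrib-+ (choose low (λ _ → 0) (λ _ → θ)) (choose low (λ _ → 0) (λ l → y l ∸ θ))) ⟩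
      ∑ (λ l → choose low (λ _ → 0) (λ _ → θ) l + choose low (λ _ → 0) (λ l → y l ∸ θ) l)
        ≡⟨ sum-cong-≗ recombine ⟩
      outside ∎
      where
      open ≡-Reasoning
      excess-off-low : ∀ l → lookup x l ∸ (lookup a l + θ) ≡ choose low (λ _ → 0) (λ l → y l ∸ θ) l
      excess-off-low l with l ∈ᶠ? low
      ... | yes l∈low = trans (sym (∸-+-assoc (lookup x l) (lookup a l) θ)) (m≤n⇒m∸n≡0 (low≤θ l∈low))
      ... | no _ = sym (∸-+-assoc (lookup x l) (lookup a l) θ)
      recombine : ∀ l → choose low (λ _ → 0) (λ _ → θ) l + choose low (λ _ → 0) (λ l → y l ∸ θ) l ≡ choose low (λ _ → 0) y l
      recombine l with l ∈ᶠ? low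
      ... | yes _ = refl
      ... | no l∉low = m+[n∸m]≡n (θ≤high l∉low)

    x∈K : x ∈ K r n a d
    x∈K = K-complete r n>0 a d (θ , ≤-trans (≤-reflexive excess-at-θ) outside≤d)

  cover : Cover r s n A
  cover = record { depth = d ; base = a ; weight = weight ; covers = x∈K }

maxUpTo-upper : ∀ N (f : ℕ → ℕ) {d} → d ≤ N → f d ≤ maxUpTo N f
maxUpTo-upper N f d≤N = foldr-⊔-upper _ (∈-map⁺ f (∈-upTo⁺ (s≤s d≤N)))

-- Given a cover of A by K(r,n,base,depth), balancing the base gives the bound;
-- when the bound is attained the base is balanced and A fills K(r,n,base,depth).
module FromCover {n r s : ℕ} .{{_ : NonZero r}} (n>0 : 0 < n) (A : List (Vec ℕ n)) (A-unique : Unique A)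
                 (bal : ℕ → Vec ℕ n)
                 (bal-ok : (d′ : ℕ) → d′ ≤ s / r → Balanced (bal d′) × ∣ bal d′ ∣ᵥ ≡ s ∸ r * d′)
                 (C : Cover r s n A) where

  open Cover C

  best : ℕ
  best = maxUpTo (s / r) (λ d′ → ∣K∣ r n (bal d′) d′)

  depth≤ : depth ≤ s / r
  depth≤ = *≤⇒≤/ r (m+n≤o⇒n≤o ∣ base ∣ᵥ (≤-reflexive weight))

  ∣base∣ : ∣ base ∣ᵥ ≡ s ∸ r * depth
  ∣base∣ = trans (sym (m+n∸n≡m ∣ base ∣ᵥ (r * depth))) (cong (_∸ r * depth) weight)

  open Balancing r n n>0 depth (bal depth) (proj₁ (bal-ok depth depth≤))

  ∣base∣≡∣bal∣ : ∣ base ∣ᵥ ≡ ∣ bal depth ∣ᵥ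
  ∣base∣≡∣bal∣ = trans ∣base∣ (sym (proj₂ (bal-ok depth depth≤)))

  A≤K : length A ≤ ∣K∣ r n base depth
  A≤K = unique-⊆⇒≤-distinct A-unique covers

  K≤best : ∣K∣ r n base depth ≤ best
  K≤best = ≤-trans (balance-≤ base ∣base∣≡∣bal∣) (maxUpTo-upper (s / r) (λ d′ → ∣K∣ r n (bal d′) d′) depth≤)

  bound : length A ≤ best
  bound = ≤-trans A≤K K≤best

  equality : length A ≡ best →
             ∃[ d′ ] ∃[ a′ ] (d′ ≤ s / r × Balanced a′ × ∣ a′ ∣ᵥ ≡ s ∸ r * d′ × A ≐ K r n a′ d′)
  equality A≡best with balanced? base
  ... | no unbalanced = ⊥-elim (<⇒≱ (balance-< base ∣base∣≡∣bal∣ unbalanced)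
    (≤-trans (maxUpTo-upper (s / r) (λ d′ → ∣K∣ r n (bal d′) d′) depth≤) (≤-trans (≤-reflexive (sym A≡best)) A≤K)))
  ... | yes balanced = depth , base , depth≤ , balanced , ∣base∣ ,
    λ x → mk⇔ covers (unique-⊆-saturated A-unique covers (≤-trans K≤best (≤-reflexive (sym A≡best))))

theorem2 : (n r s : ℕ) → 0 < n → 0 < s → r < n → .{{_ : NonZero r}}
    → (A : List (Vec ℕ n)) → Unique A → IsUnion r s A
    → (d : ℕ) → ∣ maxVec A ∣ᵥ ≡ s + (n ∸ r) * d
    → ((i : Fin n) → d ≤ Data.Vec.lookup (maxVec A) i)
    → ((i : Fin n) → plusAt (map (_∸ d) (maxVec A)) i d ∈ A)
    → (bal : ℕ → Vec ℕ n)
    → ((d' : ℕ) → d' ≤ s / r → Balanced (bal d') × ∣ bal d' ∣ᵥ ≡ s ∸ r * d')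
    → (length A ≤ maxUpTo (s / r) (λ d' → ∣K∣ r n (bal d') d'))
      × (length A ≡ maxUpTo (s / r) (λ d' → ∣K∣ r n (bal d') d')
         → ∃[ d' ] ∃[ a' ] (d' ≤ s / r × Balanced a' × ∣ a' ∣ᵥ ≡ s ∸ r * d' × A ≐ K r n a' d'))
theorem2 n zero s _ _ _ {{r≢0}} = Irrelevant.⊥-elim (NonZero.nonZero r≢0)
theorem2 n (suc zero) s n>0 _ _ A A-unique A-union _ _ _ _ bal bal-ok = bound , equality
  where
  s≤s/1 : s ≤ s / 1
  s≤s/1 = ≤-reflexive (sym (n/1≡n s))
  open FromCover n>0 A A-unique bal bal-ok (cover₁ n>0 A A-union (bal s) (proj₂ (bal-ok s s≤s/1)))
theorem2 n (suc (suc r″)) s n>0 _ r<n A A-unique A-union d ∣m∣≡ d≤m P∈A bal bal-ok = bound , equality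
  where open FromCover n>0 A A-unique bal bal-ok (Covering.cover n r″ s r<n A A-union d ∣m∣≡ d≤m P∈A)
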